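{- Let $G$ be an HRLQ instance and let $M_s$ be a stable matching of $G$ (stability being defined ignoring lower quotas). If $M_s$ is feasible, then $M_s$ is a maximum-size feasible envy-free matching of $G$.
   Context: An HRLQ instance is a bipartite graph $G=(\mathcal{R}\cup\mathcal{H},E)$ with residents $\mathcal{R}$ and hospitals $\mathcal{H}$; $(r,h)\in E$ means mutual acceptability. Each hospital $h$ has an upper quota $q^+(h)$ and a lower quota $q^-(h)\le q^+(h)$. Every vertex ranks its neighbours strictly; $b_1>_a b_2$ means $a$ prefers $b_1$. A matching $M\subseteq E$ assigns each resident at most one hospital and each hospital $h$ at most $q^+(h)$ residents; $M(r)$ is $r$'s hospital ($\bot$ if unmatched, worst for $r$), $M(h)$ the residents of $h$; $h$ is under-subscribed if $|M(h)|<q^+(h)$. $M$ is feasible if $|M(h)|\ge q^-(h)$ for all $h$. A pair $(r,h)\in E\setminus M$ blocks $M$ if $h>_r M(r)$ and either $h$ is under-subscribed or some $r'\in M(h)$ has $r>_h r'$; $M$ is stable if no blocking pair exists. A resident $r$ envies a matched resident $r'$ with $M(r')=h$, $(r,h)\in E$, if $h>_r M(r)$ and $r>_h r'$; $M$ is envy-free if no such pair exists. -}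

module Defs where

open import Data.Nat using (ℕ; zero; suc; _+_; _≤_; _<_)
open import Data.Fin using (Fin; zero; suc; _≟_)
open import Data.Bool using (Bool; true; false; if_then_else_)
open import Data.Maybe using (Maybe; just; nothing; is-just)
open import Data.Product using (Σ; ∃; ∃-syntax; _×_; _,_)
open import Data.Sum using (_⊎_)
open import Data.Unit using (⊤)
open import Relation.Nullary using (¬_; does)
open import Relation.Binary.PropositionalEquality using (_≡_)

countFin : ∀ {n} → (Fin n → Bool) → ℕ
countFin {zero}  p = 0
countFin {suc n} p = (if p zero then 1 else 0) + countFin (λ i → p (suc i))

-- An HRLQ instance: residents Fin nR, hospitals Fin nH, acceptability
-- relation E, strict preference lists given by ranks (smaller rank =
-- more preferred), injective on neighbours (strictness).
record HRLQ : Set₁ where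
  field
    nR nH : ℕ
    E     : Fin nR → Fin nH → Set
    q⁺ q⁻ : Fin nH → ℕ
    q⁻≤q⁺ : ∀ h → q⁻ h ≤ q⁺ h
    rankR : Fin nR → Fin nH → ℕ
    rankH : Fin nH → Fin nR → ℕ
    rankR-strict : ∀ r h h' → E r h → E r h' → rankR r h ≡ rankR r h' → h ≡ h'
    rankH-strict : ∀ h r r' → E r h → E r' h → rankH h r ≡ rankH h r' → r ≡ r'

module _ (G : HRLQ) where
  open HRLQ G

  -- an assignment of residents to hospitals (nothing = ⊥, unmatched)
  Assignment : Set
  Assignment = Fin nR → Maybe (Fin nH)

  isAt : Maybe (Fin nH) → Fin nH → Bool
  isAt nothing  h = false
  isAt (just h') h = does (h' ≟ h)

  load : Assignment → Fin nH → ℕ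
  load M h = countFin (λ r → isAt (M r) h)

  size : Assignment → ℕ
  size M = countFin (λ r → is-just (M r))

  IsMatching : Assignment → Set
  IsMatching M = (∀ r h → M r ≡ just h → E r h) × (∀ h → load M h ≤ q⁺ h)

  Feasible : Assignment → Set
  Feasible M = ∀ h → q⁻ h ≤ load M h

  PrefersR : Fin nR → Fin nH → Maybe (Fin nH) → Set
  PrefersR r h nothing   = ⊤
  PrefersR r h (just h') = rankR r h < rankR r h'

  PrefersH : Fin nH → Fin nR → Fin nR → Set
  PrefersH h r r' = rankH h r < rankH h r'

  Blocks : Assignment → Fin nR → Fin nH → Set
  Blocks M r h = E r h × ¬ (M r ≡ just h) × PrefersR r h (M r)
               × (load M h < q⁺ h ⊎ ∃[ r' ] (M r' ≡ just h × PrefersH h r r'))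

  Stable : Assignment → Set
  Stable M = ∀ r h → ¬ Blocks M r h

  Envies : Assignment → Fin nR → Fin nR → Set
  Envies M r r' = ∃[ h ] (M r' ≡ just h × E r h × PrefersR r h (M r) × PrefersH h r r')

  EnvyFree : Assignment → Set
  EnvyFree M = ∀ r r' → ¬ Envies M r r'

  MaxFeasibleEnvyFree : Assignment → Set
  MaxFeasibleEnvyFree M =
    IsMatching M × Feasible M × EnvyFree M ×
    (∀ M' → IsMatching M' → Feasible M' → EnvyFree M' → size M' ≤ size M)

-- Call a hospital h improved if M′ assigns to h some resident r that prefers h to its
-- Mₛ-partner. Stability of Mₛ makes an improved h full in Mₛ and makes h prefer each of its
-- Mₛ-residents to r, so by envy-freeness of M′ every Mₛ-resident of an improved hospital is
-- again at an improved hospital in M′. Since M′ places at most ∑ q⁺(h) = |Mₛ⁻¹(improved)|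
-- residents at improved hospitals, M′ and Mₛ send the same residents there. A resident
-- matched by M′ but not by Mₛ would be sent there by M′ only.
module Submission where

open import Defs
open import Data.Nat using (ℕ; zero; suc; _+_; _≤_; _<_; z≤n; s≤s; _<?_)
open import Data.Nat.Properties
  using (+-0-commutativeMonoid; +-identityʳ; +-mono-≤; ≤-trans; m≤n⇒m≤1+n; <⇒≱; <-irrefl;
         ≮⇒≥; ≤∧≢⇒<; module ≤-Reasoning)
open import Algebra.Properties.CommutativeMonoid.Sum +-0-commutativeMonoid
  using (sum; ∑-distrib-+; sum-cong-≗; sum-replicate-zero)
open import Data.Fin using (Fin; zero; suc; _≟_)
open import Data.Fin.Properties using (any?; suc-injective)
open import Data.Bool using (Bool; true; false; T; if_then_else_)
open import Data.Bool.Properties using (if-eta)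
open import Data.Maybe using (Maybe; just; nothing; is-just; maybe′)
import Data.Maybe.Properties as Maybe
open import Data.Product using (∃; ∃-syntax; _×_; _,_; proj₁; proj₂)
open import Data.Sum using (_⊎_; inj₁; inj₂)
open import Data.Unit using (tt)
open import Data.Empty using (⊥-elim)
open import Function using (_∘_)
open import Relation.Nullary using (¬_; Dec; yes; no)
open import Relation.Nullary.Decidable
  using (⌊_⌋; _×-dec_; T?; toWitness; fromWitness; decidable-stable; dec-true; dec-false)
open import Relation.Unary using (_⊆′_)
open import Relation.Binary.PropositionalEquality

countFin-mono : ∀ {n} {p q : Fin n → Bool} → T ∘ p ⊆′ T ∘ q → countFin p ≤ countFin q
countFin-mono {zero}          p⊆q = z≤n
countFin-mono {suc n} {p} {q} p⊆q with p zero | q zero | p⊆q zero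
... | true  | true  | _      = s≤s (countFin-mono (p⊆q ∘ suc))
... | false | true  | _      = m≤n⇒m≤1+n (countFin-mono (p⊆q ∘ suc))
... | false | false | _      = countFin-mono (p⊆q ∘ suc)
... | true  | false | p⇒q    = ⊥-elim (p⇒q tt)

countFin-< : ∀ {n} {p q : Fin n → Bool} → T ∘ p ⊆′ T ∘ q →
             ∀ i → T (q i) → ¬ T (p i) → countFin p < countFin q
countFin-< {suc n} {p} {q} p⊆q zero qi ¬pi with p zero | q zero
... | true  | _     = ⊥-elim (¬pi tt)
... | false | true  = s≤s (countFin-mono (p⊆q ∘ suc))
countFin-< {suc n} {p} {q} p⊆q (suc i) qi ¬pi with p zero | q zero | p⊆q zero
... | true  | true  | _   = s≤s (countFin-< (p⊆q ∘ suc) i qi ¬pi)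
... | false | true  | _   = m≤n⇒m≤1+n (countFin-< (p⊆q ∘ suc) i qi ¬pi)
... | false | false | _   = countFin-< (p⊆q ∘ suc) i qi ¬pi
... | true  | false | p⇒q = ⊥-elim (p⇒q tt)

countFin-≤⇒⊇ : ∀ {n} {p q : Fin n → Bool} → T ∘ p ⊆′ T ∘ q →
               countFin q ≤ countFin p → T ∘ q ⊆′ T ∘ p
countFin-≤⇒⊇ {p = p} p⊆q q≤p i qi =
  decidable-stable (T? (p i)) (λ ¬pi → <⇒≱ (countFin-< p⊆q i qi ¬pi) q≤p)

∑-mono-≤ : ∀ {n} {f g : Fin n → ℕ} → (∀ i → f i ≤ g i) → sum f ≤ sum g
∑-mono-≤ {zero}  f≤g = z≤n
∑-mono-≤ {suc n} f≤g = +-mono-≤ (f≤g zero) (∑-mono-≤ (f≤g ∘ suc))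

∑-zero : ∀ {n} {f : Fin n → ℕ} → (∀ i → f i ≡ 0) → sum f ≡ 0
∑-zero {n} f≡0 = trans (sum-cong-≗ f≡0) (sum-replicate-zero n)

∑-concentrated : ∀ {n} (f : Fin n → ℕ) i → (∀ j → i ≢ j → f j ≡ 0) → sum f ≡ f i
∑-concentrated {suc n} f zero    f≡0 =
  trans (cong (f zero +_) (∑-zero (λ j → f≡0 (suc j) λ ()))) (+-identityʳ (f zero))
∑-concentrated {suc n} f (suc i) f≡0 =
  cong₂ _+_ (f≡0 zero λ ()) (∑-concentrated (f ∘ suc) i (λ j i≢j → f≡0 (suc j) (i≢j ∘ suc-injective)))

if-+ : ∀ b (x y : ℕ) → (if b then x + y else 0) ≡ (if b then x else 0) + (if b then y else 0)
if-+ true  x y = refl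
if-+ false x y = refl

_⇂_ : ∀ {n} → (Fin n → ℕ) → (Fin n → Bool) → Fin n → ℕ
(f ⇂ U) i = if U i then f i else 0

∑-⇂-zero : ∀ {n} (U : Fin n → Bool) → sum ((λ _ → 0) ⇂ U) ≡ 0
∑-⇂-zero U = ∑-zero (λ i → if-eta (U i))

module _ (G : HRLQ) where
  open HRLQ G

  ∑-⇂-point : (U : Fin nH → Bool) (m : Maybe (Fin nH)) →
              sum ((λ h → if isAt G m h then 1 else 0) ⇂ U) ≡ (if maybe′ U false m then 1 else 0)
  ∑-⇂-point U nothing   = ∑-⇂-zero U
  ∑-⇂-point U (just h₀) = trans (∑-concentrated (at-h₀ ⇂ U) h₀ off-h₀) at-h₀-itself
    where
      at-h₀ : Fin nH → ℕ
      at-h₀ h = if isAt G (just h₀) h then 1 else 0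
      off-h₀ : ∀ h → h₀ ≢ h → (at-h₀ ⇂ U) h ≡ 0
      off-h₀ h h₀≢h rewrite dec-false (h₀ ≟ h) h₀≢h = if-eta (U h)
      at-h₀-itself : (at-h₀ ⇂ U) h₀ ≡ (if U h₀ then 1 else 0)
      at-h₀-itself rewrite dec-true (h₀ ≟ h₀) refl = refl

  countFin-preimage : ∀ {n} (U : Fin nH → Bool) (f : Fin n → Maybe (Fin nH)) →
    countFin (maybe′ U false ∘ f) ≡ sum ((λ h → countFin (λ i → isAt G (f i) h)) ⇂ U)
  countFin-preimage {zero}  U f = sym (∑-⇂-zero U)
  countFin-preimage {suc n} U f = begin
    (if maybe′ U false (f zero) then 1 else 0) + countFin (maybe′ U false ∘ f ∘ suc)
      ≡⟨ cong₂ _+_ (sym (∑-⇂-point U (f zero))) (countFin-preimage U (f ∘ suc)) ⟩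
    sum (head ⇂ U) + sum (tail ⇂ U)
      ≡⟨ sym (∑-distrib-+ (head ⇂ U) (tail ⇂ U)) ⟩
    sum (λ h → (head ⇂ U) h + (tail ⇂ U) h)
      ≡⟨ sum-cong-≗ (λ h → sym (if-+ (U h) (head h) (tail h))) ⟩
    sum ((λ h → countFin (λ i → isAt G (f i) h)) ⇂ U) ∎
    where
      open ≡-Reasoning
      head tail : Fin nH → ℕ
      head h = if isAt G (f zero) h then 1 else 0
      tail h = countFin (λ i → isAt G (f (suc i)) h)

  prefers⇒≢ : ∀ {r h m} → PrefersR G r h m → m ≢ just h
  prefers⇒≢ r-prefers refl = <-irrefl refl r-prefers

  prefersR? : ∀ r h m → Dec (PrefersR G r h m)
  prefersR? r h nothing   = yes tt
  prefersR? r h (just h′) = rankR r h <? rankR r h′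

  ¬prefersR⇒prefersR : ∀ {r h h′} → E r h → E r h′ → h′ ≢ h →
                       ¬ PrefersR G r h (just h′) → PrefersR G r h′ (just h)
  ¬prefersR⇒prefersR {r} {h} {h′} e e′ h′≢h ¬pr =
    ≤∧≢⇒< (≮⇒≥ ¬pr) (h′≢h ∘ rankR-strict r h′ h e′ e)

  ¬prefersH⇒prefersH : ∀ {h r r′} → E r h → E r′ h → r ≢ r′ →
                       ¬ PrefersH G h r′ r → PrefersH G h r r′
  ¬prefersH⇒prefersH {h} {r} {r′} e e′ r≢r′ ¬ph =
    ≤∧≢⇒< (≮⇒≥ ¬ph) (r≢r′ ∘ rankH-strict h r r′ e e′)

  stable⇒envyFree : ∀ {M} → Stable G M → EnvyFree G M
  stable⇒envyFree stable r r′ (h , M[r′]≡h , e , r-prefers , h-prefers) =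
    stable r h (e , prefers⇒≢ r-prefers , r-prefers , inj₂ (r′ , M[r′]≡h , h-prefers))

module Improvement (G : HRLQ) (Mₛ M′ : Assignment G)
  (Mₛ-matching : IsMatching G Mₛ) (Mₛ-stable : Stable G Mₛ)
  (M′-matching : IsMatching G M′) (M′-envyFree : EnvyFree G M′) where
  open HRLQ G

  Improves : Fin nH → Fin nR → Set
  Improves h r = M′ r ≡ just h × PrefersR G r h (Mₛ r)

  improves? : ∀ h r → Dec (Improves h r)
  improves? h r = Maybe.≡-dec _≟_ (M′ r) (just h) ×-dec prefersR? G r h (Mₛ r)

  improved : Fin nH → Bool
  improved h = ⌊ any? (improves? h) ⌋

  improver : ∀ {h} → T (improved h) → ∃ (Improves h)
  improver {h} = toWitness {a? = any? (improves? h)}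

  inImproved : Maybe (Fin nH) → Bool
  inImproved = maybe′ improved false

  improves⇒unblocked : ∀ {h r₀} → Improves h r₀ →
                       ¬ (load G Mₛ h < q⁺ h ⊎ ∃[ r ] (Mₛ r ≡ just h × PrefersH G h r₀ r))
  improves⇒unblocked {h} {r₀} (M′[r₀]≡h , r₀-prefers) blocking =
    Mₛ-stable r₀ h (proj₁ M′-matching r₀ h M′[r₀]≡h , prefers⇒≢ G r₀-prefers , r₀-prefers , blocking)

  improved⇒full : ∀ {h} → T (improved h) → q⁺ h ≤ load G Mₛ h
  improved⇒full up with improver up
  ... | _ , r₀-improves = ≮⇒≥ (improves⇒unblocked r₀-improves ∘ inj₁)

  improves⇒outranked : ∀ {h r₀ r} → Improves h r₀ → Mₛ r ≡ just h → PrefersH G h r r₀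
  improves⇒outranked {h} {r₀} {r} r₀-improves@(M′[r₀]≡h , r₀-prefers) Mₛ[r]≡h =
    ¬prefersH⇒prefersH G (proj₁ Mₛ-matching r h Mₛ[r]≡h) (proj₁ M′-matching r₀ h M′[r₀]≡h)
      (λ { refl → prefers⇒≢ G r₀-prefers Mₛ[r]≡h })
      (λ r₀-preferred → improves⇒unblocked r₀-improves (inj₂ (r , Mₛ[r]≡h , r₀-preferred)))

  not-envious : ∀ {h r₀ r} → Improves h r₀ → Mₛ r ≡ just h → ¬ PrefersR G r h (M′ r)
  not-envious {h} {r₀} {r} r₀-improves@(M′[r₀]≡h , _) Mₛ[r]≡h r-prefers =
    M′-envyFree r r₀ (h , M′[r₀]≡h , proj₁ Mₛ-matching r h Mₛ[r]≡h , r-prefers ,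
                      improves⇒outranked r₀-improves Mₛ[r]≡h)

  stays-improved : ∀ {r h} → Mₛ r ≡ just h → T (improved h) → T (inImproved (M′ r))
  stays-improved {r} {h} Mₛ[r]≡h up with improver up | M′ r in M′[r]≡
  ... | _ , r₀-improves | nothing =
    ⊥-elim (not-envious r₀-improves Mₛ[r]≡h (subst (PrefersR G r h) (sym M′[r]≡) tt))
  ... | _ , r₀-improves | just h′ with h′ ≟ h
  ...   | yes refl = up
  ...   | no h′≢h = fromWitness (r , M′[r]≡ , subst (PrefersR G r h′) (sym Mₛ[r]≡h) r-prefers-h′)
    where
      r-prefers-h′ : PrefersR G r h′ (just h)
      r-prefers-h′ = ¬prefersR⇒prefersR G (proj₁ Mₛ-matching r h Mₛ[r]≡h)
        (proj₁ M′-matching r h′ M′[r]≡) h′≢h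
        (not-envious r₀-improves Mₛ[r]≡h ∘ subst (PrefersR G r h) (sym M′[r]≡))

  improved-Mₛ⊆M′ : T ∘ inImproved ∘ Mₛ ⊆′ T ∘ inImproved ∘ M′
  improved-Mₛ⊆M′ r with Mₛ r in Mₛ[r]≡
  ... | just h = stays-improved Mₛ[r]≡

  improved-count-M′≤Mₛ : countFin (inImproved ∘ M′) ≤ countFin (inImproved ∘ Mₛ)
  improved-count-M′≤Mₛ = begin
    countFin (inImproved ∘ M′)                          ≡⟨ countFin-preimage G improved M′ ⟩
    sum (load G M′ ⇂ improved)                          ≤⟨ ∑-mono-≤ fewer ⟩
    sum (load G Mₛ ⇂ improved)                          ≡⟨ countFin-preimage G improved Mₛ ⟨
    countFin (inImproved ∘ Mₛ)                          ∎
    where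
      open ≤-Reasoning
      fewer : ∀ h → (if improved h then load G M′ h else 0) ≤ (if improved h then load G Mₛ h else 0)
      fewer h with improved h | improved⇒full {h}
      ... | true  | full = ≤-trans (proj₂ M′-matching h) (full tt)
      ... | false | _    = z≤n

  improved-M′⊆Mₛ : T ∘ inImproved ∘ M′ ⊆′ T ∘ inImproved ∘ Mₛ
  improved-M′⊆Mₛ = countFin-≤⇒⊇ improved-Mₛ⊆M′ improved-count-M′≤Mₛ

  matched-M′⊆matched-Mₛ : T ∘ is-just ∘ M′ ⊆′ T ∘ is-just ∘ Mₛ
  matched-M′⊆matched-Mₛ r _ with M′ r in M′[r]≡ | Mₛ r in Mₛ[r]≡ | improved-M′⊆Mₛ r
  ... | just _ | just _  | _                = tt
  ... | just h | nothing | improved-excluded =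
    improved-excluded (fromWitness (r , M′[r]≡ , subst (PrefersR G r h) (sym Mₛ[r]≡) tt))

lemma3 : (G : HRLQ) (Ms : Assignment G) →
         IsMatching G Ms → Stable G Ms → Feasible G Ms →
         MaxFeasibleEnvyFree G Ms
lemma3 G Mₛ Mₛ-matching Mₛ-stable Mₛ-feasible =
  Mₛ-matching , Mₛ-feasible , stable⇒envyFree G Mₛ-stable ,
  λ M′ M′-matching _ M′-envyFree →
    countFin-mono (Improvement.matched-M′⊆matched-Mₛ
                     G Mₛ M′ Mₛ-matching Mₛ-stable M′-matching M′-envyFree)
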